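{- For any plane tree $t$ and any $u\in t$, if $|\theta_ut|/|t|<(1+\Phi(t))^{ -1}$ then $\varphi_t(u)>\varphi_t(\varnothing)$.
   Context: $\mathbb{U}$ is the set of finite words over $\{1,2,\dots\}$ with empty word $\varnothing$; $u*v$ concatenation; $u\preceq v$ means $u$ is a prefix of $v$; for $u\ne\varnothing$, $\overleftarrow u$ is $u$ minus its last letter. A plane tree is a finite $t\subset\mathbb{U}$ with $\varnothing\in t$, $\overleftarrow u\in t$ for all $u\in t\setminus\{\varnothing\}$, and such that for each $u\in t$ there is $k_u(t)\ge0$ with $u*j\in t\iff1\le j\le k_u(t)$; it is a graph tree with edges $\{\overleftarrow u,u\}$. $\theta_ut=\{v:u*v\in t\}$. Centrality: $\varphi_t(u)=\prod_{v\in t,\,v\not\preceq u}|\theta_vt|\cdot\prod_{v\in t,\,\varnothing\ne v\preceq u}(|t|-|\theta_vt|)$; competitive ratio $\Phi(t)=\varphi_t(\varnothing)/\min_{w\in t}\varphi_t(w)$. -}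

module Defs where

open import Data.Nat using (ℕ; zero; suc; _+_; _*_; _∸_; _≤_; _⊓_)
open import Data.Nat.Properties using (_≟_)
open import Data.Nat.ListAction using (product)
open import Data.List using (List; []; _∷_; _++_; [_]; length; map; filter; drop; foldr)
open import Data.List.Membership.Propositional using (_∈_)
open import Data.List.Relation.Unary.Unique.Propositional using (Unique)
open import Data.List.Relation.Binary.Prefix.Heterogeneous using (Prefix)
open import Data.List.Relation.Binary.Prefix.Heterogeneous.Properties using (prefix?)
open import Data.Product using (Σ; _×_)
open import Relation.Binary.PropositionalEquality using (_≡_; _≢_)
open import Relation.Nullary using (¬_; Dec; yes; no)

open import Relation.Nullary.Decidable using (_×-dec_; ¬?)
open import Function.Bundles using (_⇔_)

-- Words of 𝕌: finite words over the letters 1,2,...  (letters are stored as ℕ;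
-- positivity of the letters occurring in a plane tree is forced by the
-- child condition in the definition of PlaneTree below).
Word : Set
Word = List ℕ

_⪯_ : Word → Word → Set
u ⪯ v = Prefix _≡_ u v

_⪯?_ : (u v : Word) → Dec (u ⪯ v)
u ⪯? v = prefix? _≟_ u v

parent : Word → Word
parent []           = []
parent (x ∷ [])     = []
parent (x ∷ y ∷ xs) = x ∷ parent (y ∷ xs)

record PlaneTree : Set where
  field
    elems    : List Word
    unique   : Unique elems
    root     : [] ∈ elems
    closed   : ∀ u → u ∈ elems → u ≢ [] → parent u ∈ elems
    children : ∀ u → u ∈ elems →
               Σ ℕ λ k → ∀ j → ((u ++ [ j ]) ∈ elems ⇔ (1 ≤ j × j ≤ k))
open PlaneTree public

_∈ᵗ_ : Word → PlaneTree → Set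
u ∈ᵗ t = u ∈ elems t

size : PlaneTree → ℕ
size t = length (elems t)

-- θ_v t = { w : v * w ∈ t }, as a list (duplicate-free since elems t is)
θ : Word → PlaneTree → List Word
θ v t = map (drop (length v)) (filter (v ⪯?_) (elems t))

∣θ∣ : Word → PlaneTree → ℕ
∣θ∣ v t = length (θ v t)

isEmpty? : (v : Word) → Dec (v ≡ [])
isEmpty? []      = yes _≡_.refl
isEmpty? (_ ∷ _) = no (λ ())

φ : PlaneTree → Word → ℕ
φ t u =
  product (map (λ v → ∣θ∣ v t) (filter (λ v → ¬? (v ⪯? u)) (elems t)))
  * product (map (λ v → size t ∸ ∣θ∣ v t)
                 (filter (λ v → ¬? (isEmpty? v) ×-dec (v ⪯? u)) (elems t)))

-- min_{w ∈ t} φ_t(w)   (the list elems t is nonempty since ∅ ∈ t;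
-- the seed φ_t(∅) is itself one of the values, so this is exactly the minimum)
minφ : PlaneTree → ℕ
minφ t = foldr _⊓_ (φ t []) (map (φ t) (elems t))

-- Moving from ←u to its child u, the vertex u stops being a non-ancestor (factor |θ_u t|)
-- and becomes an ancestor (factor |t| − |θ_u t|); every other factor of φ is unchanged, so
--   φ_t(u) · |θ_u t| = φ_t(←u) · (|t| − |θ_u t|) ≥ min φ_t · (|t| − |θ_u t|),
-- while the hypothesis, cleared of denominators, says φ_t(∅) · |θ_u t| < min φ_t · (|t| − |θ_u t|).
-- For u = ∅ the hypothesis cannot hold, as θ_∅ t = t.
module Submission where

open import Defs
open import Data.Nat using (ℕ; _+_; _*_; _<_; _>_; _≤_; _∸_; _⊓_)
open import Data.Nat.Properties
open import Algebra.Properties.CommutativeSemigroup *-commutativeSemigroup using (x∙yz≈y∙xz)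
open import Data.Nat.ListAction using (product)
open import Data.Nat.Solver using (module +-*-Solver)
open import Data.List using (List; []; _∷_; map; filter; foldr; length; drop)
open import Data.List.Properties using (filter-all; filter-accept; filter-reject; length-map)
open import Data.List.Membership.Propositional using (_∈_)
open import Data.List.Relation.Unary.Any using (here; there)
import Data.List.Relation.Unary.All as All
open import Data.List.Relation.Unary.AllPairs using (_∷_)
open import Data.List.Relation.Unary.Unique.Propositional using (Unique)
open import Data.List.Relation.Binary.Prefix.Heterogeneous using ([]; _∷_)
open import Data.List.Relation.Binary.Prefix.Heterogeneous.Properties using (fromPointwise)
import Data.List.Relation.Binary.Pointwise.Properties as Pointwise
open import Data.Product using (_,_; proj₂)
open import Function using (_∘_)
open import Function.Bundles using (_⇔_; mk⇔; Equivalence)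
open import Relation.Nullary using (¬_; yes; no; contradiction)
open import Relation.Nullary.Decidable using (_×-dec_; ¬?)
open import Relation.Unary using (Pred; Decidable)
open import Relation.Binary.PropositionalEquality

open +-*-Solver using (solve; _:=_; _:+_; _:*_)
open Equivalence using (to; from)

module _ {a p q} {A : Set a} {P : Pred A p} {Q : Pred A q}
         (P? : Decidable P) (Q? : Decidable Q) where

  filter-cong-∈ : ∀ {xs} → (∀ {x} → x ∈ xs → P x ⇔ Q x) → filter P? xs ≡ filter Q? xs
  filter-cong-∈ {[]}     agree = refl
  filter-cong-∈ {x ∷ xs} agree with P? x
  ... | yes px = trans (cong (x ∷_) (filter-cong-∈ (agree ∘ there)))
                       (sym (filter-accept Q? (to (agree (here refl)) px)))
  ... | no ¬px = trans (filter-cong-∈ (agree ∘ there))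
                       (sym (filter-reject Q? (¬px ∘ from (agree (here refl)))))

  product-filter-split : (f : A → ℕ) {u : A} {xs : List A} → Unique xs → u ∈ xs →
    P u → ¬ Q u → (∀ {x} → x ∈ xs → x ≢ u → P x ⇔ Q x) →
    product (map f (filter P? xs)) ≡ f u * product (map f (filter Q? xs))
  product-filter-split f {u} {_ ∷ xs} (u∉xs ∷ _) (here refl) pu ¬qu agree = begin
    product (map f (filter P? (u ∷ xs)))  ≡⟨ cong (product ∘ map f) (filter-accept P? pu) ⟩
    f u * product (map f (filter P? xs))  ≡⟨ cong (λ ys → f u * product (map f ys)) P≡Q ⟩
    f u * product (map f (filter Q? xs))  ≡⟨ cong (λ ys → f u * product (map f ys)) (filter-reject Q? ¬qu) ⟨
    f u * product (map f (filter Q? (u ∷ xs))) ∎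
    where
    open ≡-Reasoning
    P≡Q : filter P? xs ≡ filter Q? xs
    P≡Q = filter-cong-∈ λ y∈xs → agree (there y∈xs) (All.lookup u∉xs y∈xs ∘ sym)
  product-filter-split f {u} {x ∷ xs} (x∉xs ∷ uniq) (there u∈xs) pu ¬qu agree with P? x
  ... | yes px = begin
    f x * product (map f (filter P? xs))          ≡⟨ cong (f x *_) ih ⟩
    f x * (f u * product (map f (filter Q? xs)))  ≡⟨ x∙yz≈y∙xz (f x) (f u) _ ⟩
    f u * (f x * product (map f (filter Q? xs)))  ≡⟨ cong (λ ys → f u * product (map f ys)) (filter-accept Q? qx) ⟨
    f u * product (map f (filter Q? (x ∷ xs)))    ∎
    where
    open ≡-Reasoning
    ih = product-filter-split f uniq u∈xs pu ¬qu (agree ∘ there)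
    qx : Q x
    qx = to (agree (here refl) (All.lookup x∉xs u∈xs)) px
  ... | no ¬px = trans (product-filter-split f uniq u∈xs pu ¬qu (agree ∘ there))
    (cong (λ ys → f u * product (map f ys))
          (sym (filter-reject Q? (¬px ∘ from (agree (here refl) (All.lookup x∉xs u∈xs))))))

foldr-⊓-map-≤ : ∀ {a} {A : Set a} (f : A → ℕ) (e : ℕ) {x xs} → x ∈ xs →
  foldr _⊓_ e (map f xs) ≤ f x
foldr-⊓-map-≤ f e (here refl)  = m⊓n≤m _ _
foldr-⊓-map-≤ f e (there x∈xs) = ≤-trans (m⊓n≤n _ _) (foldr-⊓-map-≤ f e x∈xs)

m*[n+o]<p*n⇒o*m<n*[p∸m] : ∀ m n o p → m * (n + o) < p * n → o * m < n * (p ∸ m)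
m*[n+o]<p*n⇒o*m<n*[p∸m] m n o p h = +-cancelʳ-< (m * n) (o * m) (n * (p ∸ m)) (begin-strict
  o * m + m * n          ≡⟨ solve 3 (λ m n o → o :* m :+ m :* n := m :* (n :+ o)) refl m n o ⟩
  m * (n + o)            <⟨ h ⟩
  p * n                  ≡⟨ cong (_* n) (sym (m∸n+n≡m m≤p)) ⟩
  (p ∸ m + m) * n        ≡⟨ *-distribʳ-+ n (p ∸ m) m ⟩
  (p ∸ m) * n + m * n    ≡⟨ cong (_+ m * n) (*-comm (p ∸ m) n) ⟩
  n * (p ∸ m) + m * n    ∎)
  where
  open ≤-Reasoning
  m≤p : m ≤ p
  m≤p = <⇒≤ (*-cancelʳ-< n m p (≤-<-trans (*-monoʳ-≤ m (m≤m+n n o)) h))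

⪯-refl : ∀ u → u ⪯ u
⪯-refl u = fromPointwise (Pointwise.refl refl)

⪯∧≢⇒⪯-parent : ∀ {v u} → v ⪯ u → v ≢ u → v ⪯ parent u
⪯∧≢⇒⪯-parent {[]}    _                    _   = []
⪯∧≢⇒⪯-parent {_ ∷ _} {_ ∷ []}     (refl ∷ []) v≢u = contradiction refl v≢u
⪯∧≢⇒⪯-parent {_ ∷ _} {x ∷ _ ∷ _} (refl ∷ v⪯u) v≢u =
  refl ∷ ⪯∧≢⇒⪯-parent v⪯u (v≢u ∘ cong (x ∷_))

⪯-parent⇒⪯ : ∀ {v u} → v ⪯ parent u → v ⪯ u
⪯-parent⇒⪯ {[]}                   _          = []
⪯-parent⇒⪯ {_ ∷ _} {_ ∷ _ ∷ _} (e ∷ v⪯pu) = e ∷ ⪯-parent⇒⪯ v⪯pu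

⋠-parent : ∀ x xs → ¬ (x ∷ xs) ⪯ parent (x ∷ xs)
⋠-parent x []       ()
⋠-parent x (y ∷ ys) (_ ∷ u⪯pu) = ⋠-parent y ys u⪯pu

-- φ t u is definitionally offPathFactor t u * pathFactor t u.
offPathFactor : PlaneTree → Word → ℕ
offPathFactor t u = product (map (λ v → ∣θ∣ v t) (filter (λ v → ¬? (v ⪯? u)) (elems t)))

pathFactor : PlaneTree → Word → ℕ
pathFactor t u =
  product (map (λ v → size t ∸ ∣θ∣ v t) (filter (λ v → ¬? (isEmpty? v) ×-dec (v ⪯? u)) (elems t)))

offPathFactor-parent : ∀ t x xs → (x ∷ xs) ∈ᵗ t →
  offPathFactor t (parent (x ∷ xs)) ≡ ∣θ∣ (x ∷ xs) t * offPathFactor t (x ∷ xs)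
offPathFactor-parent t x xs u∈t =
  product-filter-split (λ v → ¬? (v ⪯? parent (x ∷ xs))) (λ v → ¬? (v ⪯? (x ∷ xs)))
    (λ v → ∣θ∣ v t) (unique t) u∈t (⋠-parent x xs) (λ ¬u⪯u → ¬u⪯u (⪯-refl (x ∷ xs)))
    λ _ v≢u → mk⇔ (λ v⋠pu v⪯u → v⋠pu (⪯∧≢⇒⪯-parent v⪯u v≢u))
                  (λ v⋠u v⪯pu → v⋠u (⪯-parent⇒⪯ v⪯pu))

pathFactor-parent : ∀ t x xs → (x ∷ xs) ∈ᵗ t →
  pathFactor t (x ∷ xs) ≡ (size t ∸ ∣θ∣ (x ∷ xs) t) * pathFactor t (parent (x ∷ xs))
pathFactor-parent t x xs u∈t =
  product-filter-split (λ v → ¬? (isEmpty? v) ×-dec (v ⪯? (x ∷ xs)))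
    (λ v → ¬? (isEmpty? v) ×-dec (v ⪯? parent (x ∷ xs)))
    (λ v → size t ∸ ∣θ∣ v t) (unique t) u∈t ((λ ()) , ⪯-refl (x ∷ xs)) (⋠-parent x xs ∘ proj₂)
    λ _ v≢u → mk⇔ (λ (v≢[] , v⪯u)  → v≢[] , ⪯∧≢⇒⪯-parent v⪯u v≢u)
                  (λ (v≢[] , v⪯pu) → v≢[] , ⪯-parent⇒⪯ v⪯pu)

φ-child-parent : ∀ t x xs → (x ∷ xs) ∈ᵗ t →
  φ t (x ∷ xs) * ∣θ∣ (x ∷ xs) t ≡ φ t (parent (x ∷ xs)) * (size t ∸ ∣θ∣ (x ∷ xs) t)
φ-child-parent t x xs u∈t = begin
  offPathFactor t u * pathFactor t u * s
    ≡⟨ cong (λ z → offPathFactor t u * z * s) (pathFactor-parent t x xs u∈t) ⟩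
  offPathFactor t u * (c * pathFactor t pu) * s
    ≡⟨ solve 4 (λ a b c s → a :* (c :* b) :* s := s :* a :* b :* c) refl
             (offPathFactor t u) (pathFactor t pu) c s ⟩
  s * offPathFactor t u * pathFactor t pu * c
    ≡⟨ cong (λ z → z * pathFactor t pu * c) (sym (offPathFactor-parent t x xs u∈t)) ⟩
  offPathFactor t pu * pathFactor t pu * c ∎
  where
  open ≡-Reasoning
  u  = x ∷ xs
  pu = parent u
  s  = ∣θ∣ u t
  c  = size t ∸ s

minφ≤φ : ∀ t {w} → w ∈ᵗ t → minφ t ≤ φ t w
minφ≤φ t = foldr-⊓-map-≤ (φ t) (φ t [])

∣θ∣[]≡size : ∀ t → ∣θ∣ [] t ≡ size t
∣θ∣[]≡size t = trans (length-map (drop 0) (filter ([] ⪯?_) (elems t)))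
                     (cong length (filter-all ([] ⪯?_) {elems t} (All.tabulate (λ _ → []))))

lemma2p2 : (t : PlaneTree) (u : Word) → u ∈ᵗ t →
    ∣θ∣ u t * (minφ t + φ t []) < size t * minφ t →
    φ t u > φ t []
lemma2p2 t [] _ h =
  contradiction (subst (λ s → s * (minφ t + φ t []) < size t * minφ t) (∣θ∣[]≡size t) h)
                (≤⇒≯ (*-monoʳ-≤ (size t) (m≤m+n (minφ t) (φ t []))))
lemma2p2 t (x ∷ xs) u∈t h = *-cancelʳ-< s (φ t []) (φ t (x ∷ xs)) (begin-strict
  φ t [] * s                            <⟨ m*[n+o]<p*n⇒o*m<n*[p∸m] s (minφ t) (φ t []) (size t) h ⟩
  minφ t * (size t ∸ s)                 ≤⟨ *-monoˡ-≤ (size t ∸ s) (minφ≤φ t pu∈t) ⟩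
  φ t (parent (x ∷ xs)) * (size t ∸ s)  ≡⟨ φ-child-parent t x xs u∈t ⟨
  φ t (x ∷ xs) * s                      ∎)
  where
  open ≤-Reasoning
  s = ∣θ∣ (x ∷ xs) t
  pu∈t = closed t (x ∷ xs) u∈t (λ ())
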